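{- Let $k\ge 2$ and $n$ be positive integers. Let $A \subseteq S_n$ be an equivalence class under the $\{12\cdots k,\ k\cdots 21\}$-equivalence and let $p_A = a_1a_2\cdots a_n$ be the lexicographically smallest element of $A$. Then for every $1\le i\le n$, $i-(k-1)^2 \leq a_i \leq i+(k-1)^2$.
   Context: $S_n$ is the set of permutations of $\{1,\dots,n\}$ written as words. A pattern-replacement under the $\{12\cdots k, k\cdots 21\}$-equivalence takes $k$ letters of a permutation, at arbitrary (not necessarily adjacent) positions, that are in increasing (resp. decreasing) order and rearranges them within those positions into decreasing (resp. increasing) order; two permutations are equivalent if one is reachable from the other by finitely many such replacements. Lexicographic order compares words from the first letter. -}

module Defs where

open import Data.Nat using (ℕ; _<_)
open import Data.Fin using (Fin; toℕ; opposite) renaming (_<_ to _<ᶠ_)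
open import Data.Product using (Σ; ∃; _×_)
open import Data.Sum using (_⊎_)
open import Relation.Binary.PropositionalEquality using (_≡_; _≢_)
open import Relation.Binary.Construct.Closure.ReflexiveTransitive using (Star)
open import Function.Definitions using (Injective)

-- A word of length n over {0,…,n-1} (0-based: letter v stands for v+1,
-- position i stands for i+1).
Word : ℕ → Set
Word n = Fin n → Fin n

IsPerm : ∀ {n} → Word n → Set
IsPerm σ = Injective _≡_ _≡_ σ

StrictIncr : ∀ {k n} → (Fin k → Fin n) → Set
StrictIncr {k} pos = ∀ (a b : Fin k) → a <ᶠ b → pos a <ᶠ pos b

Step : (k : ℕ) → ∀ {n} → Word n → Word n → Set
Step k {n} σ τ =
  Σ (Fin k → Fin n) λ pos →
    StrictIncr pos
    × ((∀ (a b : Fin k) → a <ᶠ b → σ (pos a) <ᶠ σ (pos b))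
       ⊎ (∀ (a b : Fin k) → a <ᶠ b → σ (pos b) <ᶠ σ (pos a)))
    × (∀ (j : Fin k) → τ (pos j) ≡ σ (pos (opposite j)))
    × (∀ (x : Fin n) → (∀ (j : Fin k) → pos j ≢ x) → τ x ≡ σ x)

Equiv : (k : ℕ) → ∀ {n} → Word n → Word n → Set
Equiv k = Star (Step k)

LexLeq : ∀ {n} → Word n → Word n → Set
LexLeq {n} σ τ =
  (∀ (i : Fin n) → σ i ≡ τ i)
  ⊎ ∃ λ (i : Fin n) → (∀ (j : Fin n) → j <ᶠ i → σ j ≡ τ j) × (toℕ (σ i) < toℕ (τ i))

-- Reversing a decreasing pattern of k letters makes a word lexicographically smaller, so
-- the minimal word p has no decreasing subsequence of length k. Suppose the positions
-- after i carrying letters smaller than p i contained an increasing subsequence of length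
-- k. Reversing it makes these k letters decreasing, so p i followed by the first k - 1 of
-- them is a decreasing pattern, and reversing that lowers the letter at i while fixing
-- every earlier position, again contradicting minimality. Symmetrically, the positions
-- before i carrying larger letters contain no increasing subsequence of length k (the
-- second reversal then lowers the letter at the first of them). By Erdős–Szekeres each of
-- these two sets has at most (k - 1)² elements, and counting the positions and the values
-- below i and p i shows that p i - i and i - p i are bounded by their sizes.
module Submission where

open import Defs
open import Data.Nat as ℕ using (ℕ; zero; suc; _+_; _*_; _∸_; _^_; s≤s; z<s)
open import Data.Nat.Properties
  using (≤-refl; ≤-trans; ≤-reflexive; <-trans; <-≤-trans; <⇒≤; <⇒≢; <-irrefl; <-asym; ≮⇒≥;
         +-mono-≤; +-monoˡ-≤; +-monoʳ-≤; +-cancelʳ-≤; m+[n∸m]≡n; *-suc; *-zeroʳ; ^-identityʳ;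
         ∸-monoˡ-<; ∸-monoʳ-<; ∸-cancelʳ-≡; module ≤-Reasoning)
open import Data.Fin as Fin
  using (Fin; zero; suc; toℕ; fromℕ; fromℕ<; inject≤; inject₁; opposite; join; splitAt; _<_)
open import Data.Fin.Properties
  using (injective⇒≤; toℕ-injective; toℕ-fromℕ<; toℕ-inject≤; toℕ-inject₁; toℕ<n;
         opposite-prop; splitAt-join; <-cmp; any?; _≟_)
  renaming (_<?_ to _<ᶠ?_; _≤?_ to _≤ᶠ?_)
open import Data.List using (List; length; lookup; allFin; filter)
open import Data.List.Properties using (filter-none)
import Data.List.Relation.Unary.All as All
open import Data.List.Relation.Unary.All.Properties using (all-filter)
open import Data.List.Relation.Unary.AllPairs using (AllPairs; _∷_)
import Data.List.Relation.Unary.AllPairs.Properties as AllPairs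
open import Data.List.Relation.Unary.Any using (index)
open import Data.List.Relation.Unary.Any.Properties using (lookup-index)
open import Data.List.Membership.Propositional.Properties using (∈-filter⁺; ∈-allFin; ∈-lookup)
open import Data.Product using (∃; _×_; _,_; proj₁; proj₂)
open import Data.Sum as Sum using (_⊎_; inj₁; inj₂; [_,_]′)
import Data.Vec.Functional as Vec
open import Function using (id; _∘_)
open import Function.Definitions using (Injective)
open import Level using (0ℓ)
open import Relation.Binary using (Rel; Transitive; tri<; tri≈; tri>)
open import Relation.Binary.Construct.Closure.ReflexiveTransitive using (ε; _◅_; _◅◅_)
open import Relation.Binary.PropositionalEquality
  using (_≡_; _≢_; refl; sym; trans; cong; subst₂; module ≡-Reasoning)
open import Relation.Nullary using (¬_; Dec; yes; no; ¬?; contradiction)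
open import Relation.Nullary.Decidable using (_×-dec_)
open import Relation.Unary using (Pred; Decidable; U)
open import Relation.Unary.Properties using (U?)

record Chain {n : ℕ} (R : Rel (Fin n) 0ℓ) (l : ℕ) (S : Pred (Fin n) 0ℓ) : Set where
  field
    pos     : Fin l → Fin n
    related : ∀ a b → a < b → R (pos a) (pos b)
    inside  : ∀ a → S (pos a)
open Chain

Ascent Descent : ∀ {n m} → (Fin n → Fin m) → Rel (Fin n) 0ℓ
Ascent  τ x y = x < y × τ x < τ y
Descent τ x y = x < y × τ y < τ x

descent-trans : ∀ {n m} (τ : Fin n → Fin m) → Transitive (Descent τ)
descent-trans τ (x<y , τy<τx) (y<z , τz<τy) = <-trans x<y y<z , <-trans τz<τy τy<τx

strictIncr-injective : ∀ {k n} {pos : Fin k → Fin n} → StrictIncr pos → Injective _≡_ _≡_ pos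
strictIncr-injective incr {a} {b} e with <-cmp a b
... | tri< a<b _ _ = contradiction (cong toℕ e) (<⇒≢ (incr a b a<b))
... | tri≈ _ a≡b _ = a≡b
... | tri> _ _ b<a = contradiction (cong toℕ (sym e)) (<⇒≢ (incr b a b<a))

chain-incr : ∀ {n k} {R : Rel (Fin n) 0ℓ} {S} → (∀ {x y} → R x y → x < y) →
  (c : Chain R k S) → StrictIncr (c .pos)
chain-incr R⇒< c a b a<b = R⇒< (c .related a b a<b)

module _ {n : ℕ} where

  chain-map : ∀ {R R′ : Rel (Fin n) 0ℓ} {S S′ : Pred (Fin n) 0ℓ} {l} →
    (∀ {x y} → S x → S y → R x y → R′ x y) → (∀ {x} → S x → S′ x) →
    Chain R l S → Chain R′ l S′
  chain-map R⇒R′ S⇒S′ c .pos = c .pos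
  chain-map R⇒R′ S⇒S′ c .related a b a<b = R⇒R′ (c .inside a) (c .inside b) (c .related a b a<b)
  chain-map R⇒R′ S⇒S′ c .inside a = S⇒S′ (c .inside a)

  singleton : ∀ {R : Rel (Fin n) 0ℓ} {S : Pred (Fin n) 0ℓ} {x} → S x → Chain R 1 S
  singleton {x = x} sx .pos _ = x
  singleton sx .related zero zero ()
  singleton sx .inside _ = sx

  chain-cons : ∀ {R : Rel (Fin n) 0ℓ} {S : Pred (Fin n) 0ℓ} {l z} → Transitive R →
    (c : Chain R (suc l) S) → R z (c .pos zero) → S z → Chain R (suc (suc l)) S
  chain-cons {z = z} R-trans c Rzc sz .pos = z Vec.∷ c .pos
  chain-cons R-trans c Rzc sz .related zero (suc zero) _ = Rzc
  chain-cons R-trans c Rzc sz .related zero (suc (suc b)) _ =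
    R-trans Rzc (c .related zero (suc b) z<s)
  chain-cons R-trans c Rzc sz .related (suc a) (suc b) (s≤s a<b) = c .related a b a<b
  chain-cons R-trans c Rzc sz .inside zero = sz
  chain-cons R-trans c Rzc sz .inside (suc a) = c .inside a

module _ {n : ℕ} {R : Rel (Fin n) 0ℓ} {S : Pred (Fin n) 0ℓ} where

  chain-tail : ∀ {l} → Chain R (suc l) S → Chain R l S
  chain-tail c .pos = Vec.tail (c .pos)
  chain-tail c .related a b a<b = c .related (suc a) (suc b) (s≤s a<b)
  chain-tail c .inside a = c .inside (suc a)

  chain-init : ∀ {l} → Chain R (suc l) S → Chain R l S
  chain-init c .pos = Vec.init (c .pos)
  chain-init c .related a b a<b =
    c .related (inject₁ a) (inject₁ b)
      (subst₂ ℕ._<_ (sym (toℕ-inject₁ a)) (sym (toℕ-inject₁ b)) a<b)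
  chain-init c .inside a = c .inside (inject₁ a)

snoc : ∀ {A : Set} {l} → (Fin l → A) → A → Fin (suc l) → A
snoc {l = zero}  _ a _ = a
snoc {l = suc l} f a = f zero Vec.∷ snoc (Vec.tail f) a

snoc-last : ∀ {A : Set} {l} (f : Fin l → A) a → Vec.last (snoc f a) ≡ a
snoc-last {l = zero}  f a = refl
snoc-last {l = suc l} f a = snoc-last (Vec.tail f) a

module _ {n : ℕ} {R : Rel (Fin n) 0ℓ} {S : Pred (Fin n) 0ℓ} (R-trans : Transitive R) where

  chain-snoc : ∀ {l z} (c : Chain R (suc l) S) → R (Vec.last (c .pos)) z → S z →
    Chain R (suc (suc l)) S
  chain-snoc {z = z} c Rcz sz .pos = snoc (c .pos) z
  chain-snoc {l = zero} c Rcz sz .related =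
    chain-cons {R = R} {S = S} R-trans (singleton sz) Rcz (c .inside zero) .related
  chain-snoc {l = suc l} c Rcz sz .related = chain-cons {R = R} {S = S} R-trans
    (chain-snoc (chain-tail c) Rcz sz) (c .related zero (suc zero) z<s) (c .inside zero) .related
  chain-snoc {l = zero} c Rcz sz .inside =
    chain-cons {R = R} {S = S} R-trans (singleton sz) Rcz (c .inside zero) .inside
  chain-snoc {l = suc l} c Rcz sz .inside = chain-cons {R = R} {S = S} R-trans
    (chain-snoc (chain-tail c) Rcz sz) (c .related zero (suc zero) z<s) (c .inside zero) .inside

lookup-AllPairs : ∀ {A : Set} {R : Rel A 0ℓ} {xs : List A} → AllPairs R xs →
  ∀ {i j} → i < j → R (lookup xs i) (lookup xs j)
lookup-AllPairs (r ∷ _)  {zero}  {suc j} _ = All.lookup r (∈-lookup j)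
lookup-AllPairs (_ ∷ rs) {suc i} {suc j} (s≤s i<j) = lookup-AllPairs rs i<j

module _ {m : ℕ} {P : Pred (Fin m) 0ℓ} (P? : Decidable P) where

  members : List (Fin m)
  members = filter P? (allFin m)

  count : ℕ
  count = length members

  enum : Fin count → Fin m
  enum = lookup members

  enum-satisfies : ∀ j → P (enum j)
  enum-satisfies j = All.lookup (all-filter P? (allFin m)) (∈-lookup j)

  enum-monotone : StrictIncr enum
  enum-monotone _ _ = lookup-AllPairs (AllPairs.filter⁺ P? (AllPairs.tabulate⁺-< {R = _<_} id))

  indexOf : ∀ {x} → P x → Fin count
  indexOf {x} px = index (∈-filter⁺ P? (∈-allFin x) px)

  enum-indexOf : ∀ {x} (px : P x) → enum (indexOf px) ≡ x
  enum-indexOf {x} px = sym (lookup-index (∈-filter⁺ P? (∈-allFin x) px))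

module _ {m : ℕ} {P : Pred (Fin m) 0ℓ} (P? : Decidable P) where

  count-≤-injection : ∀ {m′} (f : ∀ x → P x → Fin m′) →
    (∀ {x y} px py → f x px ≡ f y py → x ≡ y) → count P? ℕ.≤ m′
  count-≤-injection f f-injective = injective⇒≤ λ e →
    strictIncr-injective (enum-monotone P?)
      (f-injective (enum-satisfies P? _) (enum-satisfies P? _) e)

  ≤-count-injection : ∀ {m′} (f : Fin m′ → Fin m) → Injective _≡_ _≡_ f → (∀ j → P (f j)) →
    m′ ℕ.≤ count P?
  ≤-count-injection f f-injective f-sat = injective⇒≤ λ {i} {j} e → f-injective (begin
    f i                            ≡⟨ enum-indexOf P? (f-sat i) ⟨
    enum P? (indexOf P? (f-sat i)) ≡⟨ cong (enum P?) e ⟩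
    enum P? (indexOf P? (f-sat j)) ≡⟨ enum-indexOf P? (f-sat j) ⟩
    f j                            ∎)
    where open ≡-Reasoning

  count-empty : (∀ x → ¬ P x) → count P? ≡ 0
  count-empty ¬P = cong length (filter-none P? (All.universal ¬P (allFin m)))

  ascending-of-count : ∀ {l} → l ℕ.≤ count P? → Chain _<_ l P
  ascending-of-count l≤c .pos a = enum P? (inject≤ a l≤c)
  ascending-of-count l≤c .related a b a<b = enum-monotone P? _ _
    (subst₂ ℕ._<_ (sym (toℕ-inject≤ a l≤c)) (sym (toℕ-inject≤ b l≤c)) a<b)
  ascending-of-count l≤c .inside a = enum-satisfies P? _

count-⊆-∪ : ∀ {m} {P Q R : Pred (Fin m) 0ℓ}
  (P? : Decidable P) (Q? : Decidable Q) (R? : Decidable R) →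
  (∀ x → P x → Q x ⊎ R x) → count P? ℕ.≤ count Q? + count R?
count-⊆-∪ {m} {P} P? Q? R? split = count-≤-injection P? encode λ {x} {y} px py e → begin
  x                    ≡⟨ decode-encode x px ⟨
  decode (encode x px) ≡⟨ cong decode e ⟩
  decode (encode y py) ≡⟨ decode-encode y py ⟩
  y                    ∎
  where
  open ≡-Reasoning
  encode : ∀ x → P x → Fin (count Q? + count R?)
  encode x px = join _ _ (Sum.map (indexOf Q?) (indexOf R?) (split x px))
  decode : Fin (count Q? + count R?) → Fin m
  decode = [ enum Q? , enum R? ]′ ∘ splitAt (count Q?)
  decode-encode : ∀ x px → decode (encode x px) ≡ x
  decode-encode x px
    rewrite splitAt-join (count Q?) (count R?) (Sum.map (indexOf Q?) (indexOf R?) (split x px))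
    with split x px
  ... | inj₁ qx = enum-indexOf Q? qx
  ... | inj₂ rx = enum-indexOf R? rx

module _ {n m : ℕ} {g : Fin n → Fin m} (g-injective : Injective _≡_ _≡_ g) (v : Fin m) where

  count-below-≤ : count (λ x → g x <ᶠ? v) ℕ.≤ toℕ v
  count-below-≤ = count-≤-injection _ (λ x gx<v → fromℕ< gx<v) λ {x} {y} gx<v gy<v e →
    g-injective (toℕ-injective (begin
      toℕ (g x)         ≡⟨ toℕ-fromℕ< gx<v ⟨
      toℕ (fromℕ< gx<v) ≡⟨ cong toℕ e ⟩
      toℕ (fromℕ< gy<v) ≡⟨ toℕ-fromℕ< gy<v ⟩
      toℕ (g y)         ∎))
    where open ≡-Reasoning

  count-atLeast-≤ : count (λ x → v ≤ᶠ? g x) ℕ.≤ m ∸ toℕ v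
  count-atLeast-≤ = count-≤-injection _ (λ x v≤gx → fromℕ< (shift v≤gx)) λ {x} {y} v≤gx v≤gy e →
    g-injective (toℕ-injective (∸-cancelʳ-≡ v≤gx v≤gy (begin
      toℕ (g x) ∸ toℕ v              ≡⟨ toℕ-fromℕ< (shift v≤gx) ⟨
      toℕ (fromℕ< (shift v≤gx))      ≡⟨ cong toℕ e ⟩
      toℕ (fromℕ< (shift v≤gy))      ≡⟨ toℕ-fromℕ< (shift v≤gy) ⟩
      toℕ (g y) ∸ toℕ v              ∎)))
    where
    open ≡-Reasoning
    shift : ∀ {x} → v Fin.≤ g x → toℕ (g x) ∸ toℕ v ℕ.< m ∸ toℕ v
    shift {x} = ∸-monoˡ-< (toℕ<n (g x))

-- Injectivity suffices: the values ≥ v occupy at most n - v positions.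
≤-count-below : ∀ {n} {p : Fin n → Fin n} → Injective _≡_ _≡_ p → ∀ v →
  toℕ v ℕ.≤ count (λ x → p x <ᶠ? v)
≤-count-below {n} {p} p-injective v = +-cancelʳ-≤ (n ∸ toℕ v) (toℕ v) _ (begin
  toℕ v + (n ∸ toℕ v)    ≡⟨ m+[n∸m]≡n (<⇒≤ (toℕ<n v)) ⟩
  n                      ≤⟨ ≤-count-injection (U? {A = Fin n}) id id _ ⟩
  count (U? {A = Fin n}) ≤⟨ count-⊆-∪ U? below? atLeast? below-or-atLeast ⟩
  count below? + count atLeast?   ≤⟨ +-monoʳ-≤ _ (count-atLeast-≤ p-injective v) ⟩
  count below? + (n ∸ toℕ v)      ∎)
  where
  open ≤-Reasoning
  below? : Decidable (λ x → p x < v)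
  below? x = p x <ᶠ? v
  atLeast? : Decidable (λ x → v Fin.≤ p x)
  atLeast? x = v ≤ᶠ? p x
  below-or-atLeast : ∀ x → U x → p x < v ⊎ v Fin.≤ p x
  below-or-atLeast x _ with below? x
  ... | yes px<v = inj₁ px<v
  ... | no px≮v  = inj₂ (≮⇒≥ px≮v)

module _ {n m : ℕ} {τ : Fin n → Fin m} (τ-injective : Injective _≡_ _≡_ τ) where

  -- The left-to-right maxima of S ascend; every other element of S is preceded by a
  -- larger one, which extends any descent of such elements.
  erdős-szekeres : ∀ r t {S : Pred (Fin n) 0ℓ} (S? : Decidable S) →
    ¬ Chain (Ascent τ) (suc r) S → ¬ Chain (Descent τ) (suc t) S → count S? ℕ.≤ r * t
  erdős-szekeres r zero S? no-ascent no-descent = ≤-reflexive (begin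
    count S? ≡⟨ count-empty S? (λ x sx → no-descent (singleton sx)) ⟩
    0        ≡⟨ *-zeroʳ r ⟨
    r * 0    ∎)
    where open ≡-Reasoning
  erdős-szekeres r (suc t) {S} S? no-ascent no-descent = begin
    count S?                          ≤⟨ count-⊆-∪ S? LeftMax? Overtaken? leftMax-or-overtaken ⟩
    count LeftMax? + count Overtaken? ≤⟨ +-mono-≤ leftMax-≤ overtaken-≤ ⟩
    r + r * t                         ≡⟨ *-suc r t ⟨
    r * suc t                         ∎
    where
    open ≤-Reasoning
    Overtakes : Fin n → Fin n → Set
    Overtakes x z = z < x × S z × τ x < τ z
    Overtakes? : ∀ x z → Dec (Overtakes x z)
    Overtakes? x z = (z <ᶠ? x) ×-dec S? z ×-dec (τ x <ᶠ? τ z)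
    LeftMax Overtaken : Pred (Fin n) 0ℓ
    LeftMax   x = S x × ¬ ∃ (Overtakes x)
    Overtaken x = S x × ∃ (Overtakes x)
    LeftMax? : Decidable LeftMax
    LeftMax? x = S? x ×-dec ¬? (any? (Overtakes? x))
    Overtaken? : Decidable Overtaken
    Overtaken? x = S? x ×-dec any? (Overtakes? x)

    leftMax-or-overtaken : ∀ x → S x → LeftMax x ⊎ Overtaken x
    leftMax-or-overtaken x sx with any? (Overtakes? x)
    ... | yes overtaken = inj₂ (sx , overtaken)
    ... | no ¬overtaken = inj₁ (sx , ¬overtaken)

    leftMax-ascent : ∀ {x y} → LeftMax x → LeftMax y → x < y → Ascent τ x y
    leftMax-ascent {x} {y} (sx , _) (_ , y-max) x<y with <-cmp (τ x) (τ y)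
    ... | tri< τx<τy _ _ = x<y , τx<τy
    ... | tri≈ _ τx≡τy _ = contradiction (cong toℕ (τ-injective τx≡τy)) (<⇒≢ x<y)
    ... | tri> _ _ τy<τx = contradiction (x , x<y , sx , τy<τx) y-max

    leftMax-≤ : count LeftMax? ℕ.≤ r
    leftMax-≤ = ≮⇒≥ λ r<count →
      no-ascent (chain-map leftMax-ascent proj₁ (ascending-of-count LeftMax? r<count))

    overtaken-≤ : count Overtaken? ℕ.≤ r * t
    overtaken-≤ = erdős-szekeres r t Overtaken? (no-ascent ∘ chain-map (λ _ _ → id) proj₁) λ c →
      let (z , z<c₀ , sz , τc₀<τz) = c .inside zero .proj₂
      in no-descent
           (chain-cons (descent-trans τ) (chain-map (λ _ _ → id) proj₁ c) (z<c₀ , τc₀<τz) sz)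

opposite-< : ∀ {k} {a b : Fin k} → a < b → opposite b < opposite a
opposite-< {k} {a} {b} a<b rewrite opposite-prop a | opposite-prop b =
  ∸-monoʳ-< (s≤s a<b) (toℕ<n b)

module _ {k n : ℕ} (pos : Fin k → Fin n) (τ : Word n) where

  reverseAt : Word n
  reverseAt x with any? (λ j → pos j ≟ x)
  ... | yes (j , _) = τ (pos (opposite j))
  ... | no _        = τ x

  reverseAt-pos : StrictIncr pos → ∀ j → reverseAt (pos j) ≡ τ (pos (opposite j))
  reverseAt-pos incr j with any? (λ j′ → pos j′ ≟ pos j)
  ... | yes (j′ , e) rewrite strictIncr-injective incr e = refl
  ... | no ¬hit      = contradiction (j , refl) ¬hit

  reverseAt-outside : ∀ {x} → (∀ j → pos j ≢ x) → reverseAt x ≡ τ x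
  reverseAt-outside {x} off with any? (λ j → pos j ≟ x)
  ... | yes (j , e) = contradiction e (off j)
  ... | no _        = refl

  reverseAt-step : StrictIncr pos →
    (∀ a b → a < b → τ (pos a) < τ (pos b)) ⊎ (∀ a b → a < b → τ (pos b) < τ (pos a)) →
    Step k τ reverseAt
  reverseAt-step incr monotone =
    pos , incr , monotone , reverseAt-pos incr , λ _ → reverseAt-outside

reverseAt-below : ∀ {k n} {pos : Fin (suc k) → Fin n} {τ : Word n} → StrictIncr pos →
  ∀ {x} → x < pos zero → reverseAt pos τ x ≡ τ x
reverseAt-below {pos = pos} {τ} incr x<head = reverseAt-outside pos τ λ j e →
  <⇒≢ (<-≤-trans x<head (head-≤ j)) (cong toℕ (sym e))
  where
  head-≤ : ∀ j → pos zero Fin.≤ pos j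
  head-≤ zero    = ≤-refl
  head-≤ (suc j) = <⇒≤ (incr zero (suc j) z<s)

reverse-ascent : ∀ {k n} {τ : Word n} {S} (c : Chain (Ascent τ) k S) →
  Chain (Descent (reverseAt (c .pos) τ)) k S
reverse-ascent c .pos = c .pos
reverse-ascent {τ = τ} c .related a b a<b = a<b′ , (begin-strict
  toℕ (reverseAt (c .pos) τ (c .pos b)) ≡⟨ cong toℕ (reverseAt-pos (c .pos) τ incr b) ⟩
  toℕ (τ (c .pos (opposite b)))         <⟨ c .related _ _ (opposite-< a<b) .proj₂ ⟩
  toℕ (τ (c .pos (opposite a)))         ≡⟨ cong toℕ (reverseAt-pos (c .pos) τ incr a) ⟨
  toℕ (reverseAt (c .pos) τ (c .pos a)) ∎)
  where
  open ≤-Reasoning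
  incr = chain-incr proj₁ c
  a<b′ = incr a b a<b
reverse-ascent c .inside = c .inside

lexLeq-¬improvement : ∀ {n} {p τ : Word n} {x} → LexLeq p τ →
  (∀ y → y < x → τ y ≡ p y) → ¬ τ x < p x
lexLeq-¬improvement (inj₁ p≗τ) _ τx<px = <⇒≢ τx<px (cong toℕ (sym (p≗τ _)))
lexLeq-¬improvement {x = x} (inj₂ (j , agree-before-j , pj<τj)) agree τx<px with <-cmp j x
... | tri< j<x _ _  = <⇒≢ pj<τj (cong toℕ (sym (agree j j<x)))
... | tri≈ _ refl _ = <-asym τx<px pj<τj
... | tri> _ _ x<j  = <⇒≢ τx<px (cong toℕ (sym (agree-before-j x x<j)))

LaterSmaller EarlierLarger : ∀ {n} → Word n → Fin n → Pred (Fin n) 0ℓ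
LaterSmaller  p i x = i < x × p x < p i
EarlierLarger p i x = x < i × p i < p x

module LexMinimal (d : ℕ) {n : ℕ} {p : Word n}
  (minimal : ∀ τ → Equiv (suc (suc d)) p τ → LexLeq p τ) where

  private
    k : ℕ
    k = suc (suc d)

  no-improvement : ∀ {τ x} → Equiv k p τ → (∀ y → y < x → τ y ≡ p y) → ¬ τ x < p x
  no-improvement p~τ = lexLeq-¬improvement (minimal _ p~τ)

  no-long-descent : ∀ {S} → ¬ Chain (Descent p) k S
  no-long-descent c = no-improvement (step ◅ ε) (λ _ → reverseAt-below incr) (begin-strict
    toℕ (reverseAt (c .pos) p (c .pos zero)) ≡⟨ cong toℕ (reverseAt-pos (c .pos) p incr zero) ⟩
    toℕ (p (Vec.last (c .pos)))              <⟨ c .related zero (fromℕ _) z<s .proj₂ ⟩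
    toℕ (p (c .pos zero))                    ∎)
    where
    open ≤-Reasoning
    incr = chain-incr proj₁ c
    step = reverseAt-step (c .pos) p incr (inj₂ λ a b a<b → c .related a b a<b .proj₂)

  no-long-ascent-laterSmaller : ∀ i → ¬ Chain (Ascent p) k (LaterSmaller p i)
  no-long-ascent-laterSmaller i c = no-improvement (step₁ ◅ step₂ ◅ ε) agree (begin-strict
    toℕ (τ₂ i)                     ≡⟨ cong toℕ (reverseAt-pos (c′ .pos) τ₁ incr₂ zero) ⟩
    toℕ (τ₁ (Vec.last (c′ .pos)))  <⟨ c′ .related zero (fromℕ _) z<s .proj₂ ⟩
    toℕ (τ₁ i)                     ≡⟨ cong toℕ τ₁-i ⟩
    toℕ (p i)                      ∎)
    where
    open ≤-Reasoning
    incr₁ = chain-incr proj₁ c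
    τ₁ = reverseAt (c .pos) p
    step₁ = reverseAt-step (c .pos) p incr₁ (inj₁ λ a b a<b → c .related a b a<b .proj₂)
    i<c₀ : i < c .pos zero
    i<c₀ = c .inside zero .proj₁
    τ₁-i : τ₁ i ≡ p i
    τ₁-i = reverseAt-below incr₁ i<c₀
    τ₁-c₀<τ₁-i : τ₁ (c .pos zero) < τ₁ i
    τ₁-c₀<τ₁-i = begin-strict
      toℕ (τ₁ (c .pos zero))      ≡⟨ cong toℕ (reverseAt-pos (c .pos) p incr₁ zero) ⟩
      toℕ (p (Vec.last (c .pos))) <⟨ c .inside (fromℕ _) .proj₂ ⟩
      toℕ (p i)                   ≡⟨ cong toℕ τ₁-i ⟨
      toℕ (τ₁ i)                  ∎
    c′ : Chain (Descent τ₁) k U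
    c′ = chain-cons (descent-trans τ₁) (chain-map (λ _ _ → id) _ (chain-init (reverse-ascent c)))
      (i<c₀ , τ₁-c₀<τ₁-i) _
    incr₂ = chain-incr proj₁ c′
    τ₂ = reverseAt (c′ .pos) τ₁
    step₂ = reverseAt-step (c′ .pos) τ₁ incr₂ (inj₂ λ a b a<b → c′ .related a b a<b .proj₂)
    agree : ∀ y → y < i → τ₂ y ≡ p y
    agree y y<i = trans (reverseAt-below incr₂ y<i) (reverseAt-below incr₁ (<-trans y<i i<c₀))

  no-long-ascent-earlierLarger : ∀ i → ¬ Chain (Ascent p) k (EarlierLarger p i)
  no-long-ascent-earlierLarger i c = no-improvement (step₁ ◅ step₂ ◅ ε) agree (begin-strict
    toℕ (τ₂ (c .pos zero))        ≡⟨ cong toℕ (reverseAt-pos (c′ .pos) τ₁ incr₂ zero) ⟩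
    toℕ (τ₁ (Vec.last (c′ .pos))) ≡⟨ cong (toℕ ∘ τ₁) (snoc-last (Vec.init (c .pos)) i) ⟩
    toℕ (τ₁ i)                    ≡⟨ cong toℕ τ₁-i ⟩
    toℕ (p i)                     <⟨ c .inside zero .proj₂ ⟩
    toℕ (p (c .pos zero))         ∎)
    where
    open ≤-Reasoning
    incr₁ = chain-incr proj₁ c
    τ₁ = reverseAt (c .pos) p
    step₁ = reverseAt-step (c .pos) p incr₁ (inj₁ λ a b a<b → c .related a b a<b .proj₂)
    τ₁-i : τ₁ i ≡ p i
    τ₁-i = reverseAt-outside (c .pos) p λ j e → <⇒≢ (c .inside j .proj₁) (cong toℕ e)
    τ₁-i<τ₁-c : ∀ j → τ₁ i < τ₁ (c .pos j)
    τ₁-i<τ₁-c j = begin-strict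
      toℕ (τ₁ i)                    ≡⟨ cong toℕ τ₁-i ⟩
      toℕ (p i)                     <⟨ c .inside (opposite j) .proj₂ ⟩
      toℕ (p (c .pos (opposite j))) ≡⟨ cong toℕ (reverseAt-pos (c .pos) p incr₁ j) ⟨
      toℕ (τ₁ (c .pos j))           ∎
    c′ : Chain (Descent τ₁) k U
    c′ = chain-snoc (descent-trans τ₁) (chain-map (λ _ _ → id) _ (chain-init (reverse-ascent c)))
      (c .inside _ .proj₁ , τ₁-i<τ₁-c _) _
    incr₂ = chain-incr proj₁ c′
    τ₂ = reverseAt (c′ .pos) τ₁
    step₂ = reverseAt-step (c′ .pos) τ₁ incr₂ (inj₂ λ a b a<b → c′ .related a b a<b .proj₂)
    agree : ∀ y → y < c .pos zero → τ₂ y ≡ p y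
    agree y y<c₀ = trans (reverseAt-below incr₂ y<c₀) (reverseAt-below incr₁ y<c₀)

module _ {n : ℕ} {p : Word n} (p-injective : IsPerm p) (i : Fin n) where

  laterSmaller? : Decidable (LaterSmaller p i)
  laterSmaller? x = (i <ᶠ? x) ×-dec (p x <ᶠ? p i)

  earlierLarger? : Decidable (EarlierLarger p i)
  earlierLarger? x = (x <ᶠ? i) ×-dec (p i <ᶠ? p x)

  earlier? : Decidable (λ (x : Fin n) → x < i)
  earlier? x = x <ᶠ? i

  smaller? : Decidable (λ x → p x < p i)
  smaller? x = p x <ᶠ? p i

  value-≤-position+laterSmaller : toℕ (p i) ℕ.≤ toℕ i + count laterSmaller?
  value-≤-position+laterSmaller = begin
    toℕ (p i)                            ≤⟨ ≤-count-below p-injective (p i) ⟩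
    count smaller?                       ≤⟨ count-⊆-∪ smaller? earlier? laterSmaller? split ⟩
    count earlier? + count laterSmaller? ≤⟨ +-monoˡ-≤ _ (count-below-≤ {g = id} id i) ⟩
    toℕ i + count laterSmaller?          ∎
    where
    open ≤-Reasoning
    split : ∀ x → p x < p i → x < i ⊎ LaterSmaller p i x
    split x px<pi with <-cmp x i
    ... | tri< x<i _ _  = inj₁ x<i
    ... | tri≈ _ refl _ = contradiction px<pi (<-irrefl refl)
    ... | tri> _ _ i<x  = inj₂ (i<x , px<pi)

  position-≤-value+earlierLarger : toℕ i ℕ.≤ toℕ (p i) + count earlierLarger?
  position-≤-value+earlierLarger = begin
    toℕ i                                 ≤⟨ ≤-count-below {p = id} id i ⟩
    count earlier?                        ≤⟨ count-⊆-∪ earlier? smaller? earlierLarger? split ⟩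
    count smaller? + count earlierLarger? ≤⟨ +-monoˡ-≤ _ (count-below-≤ p-injective (p i)) ⟩
    toℕ (p i) + count earlierLarger?      ∎
    where
    open ≤-Reasoning
    split : ∀ x → x < i → p x < p i ⊎ EarlierLarger p i x
    split x x<i with <-cmp (p x) (p i)
    ... | tri< px<pi _ _ = inj₁ px<pi
    ... | tri≈ _ px≡pi _ = contradiction (cong toℕ (p-injective px≡pi)) (<⇒≢ x<i)
    ... | tri> _ _ pi<px = inj₂ (x<i , pi<px)

lemma2p1 : (k n : ℕ) → 2 ℕ.≤ k → 1 ℕ.≤ n →
    (σ p : Word n) → IsPerm σ → IsPerm p →
    Equiv k σ p →
    (∀ (τ : Word n) → Equiv k σ τ → LexLeq p τ) →
    ∀ (i : Fin n) →
      (toℕ i ℕ.≤ toℕ (p i) + (k ∸ 1) ^ 2) × (toℕ (p i) ℕ.≤ toℕ i + (k ∸ 1) ^ 2)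
lemma2p1 (suc (suc d)) n _ _ σ p _ p-injective σ~p σ-minimal i =
  ≤-trans (position-≤-value+earlierLarger p-injective i)
          (+-monoʳ-≤ _ (bound (no-long-ascent-earlierLarger i))) ,
  ≤-trans (value-≤-position+laterSmaller p-injective i)
          (+-monoʳ-≤ _ (bound (no-long-ascent-laterSmaller i)))
  where
  open LexMinimal d (λ τ p~τ → σ-minimal τ (σ~p ◅◅ p~τ))
  bound : ∀ {S} {S? : Decidable S} → ¬ Chain (Ascent p) (suc (suc d)) S → count S? ℕ.≤ suc d ^ 2
  bound {S? = S?} no-ascent = begin
    count S?      ≤⟨ erdős-szekeres p-injective (suc d) (suc d) S? no-ascent no-long-descent ⟩
    suc d * suc d ≡⟨ cong (suc d *_) (^-identityʳ (suc d)) ⟨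
    suc d ^ 2     ∎
    where open ≤-Reasoning
lemma2p1 (suc zero) n (s≤s ())
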